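{- Let $\mathbf M$ be a symmetric nonnegative integer matrix that is not the zero matrix. Then there exists a proper diagram $S$ with $\mathbf B(S)=\mathbf M$ if and only if all diagonal entries and both rainbow entries of $\mathbf M$ are zero. Moreover, if $\mathbf M$ is a $(0,1)$-matrix, then such an $S$ contains no parallel arcs.
   Context: A diagram of length $n$ is a simple graph on sites $\{1,\dots,n\}$ whose edges (arcs) are pairs $(s_1,s_2)$ with $s_1<s_2$ and $1<s_2-s_1<n-1$, supported by $s_1,s_2$. A diagram is binary if it has at least one arc and each site supports at most one arc. A site is free if it supports no arc; $s$ is covered by $(s_1,s_2)$ if $s_1<s<s_2$. A diagram is proper if it is binary, each arc covers at least one free site, and no arc covers all free sites. Two arcs are parallel if they cover the same set of free sites. If $u_1<\dots<u_f$ are the free sites, $u_0=0$, $u_{f+1}=n+1$, the $i$-th block $B_i$ is the set of sites $s$ with $u_{i-1}<s<u_i$. The block matrix $\mathbf B(S)=(b_{i,j})$ is the symmetric $(f+1)\times(f+1)$ matrix where, for $i\ne j$, $b_{i,j}$ is the number of arcs with one supporting site in $B_i$ and the other in $B_j$, and $b_{i,i}$ is the number of arcs with both supporting sites in $B_i$. The rainbow entries of a matrix $(x_{i,j})$ of order $m$ are $x_{1,m}$ and $x_{m,1}$. -}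

module Defs where

open import Data.Nat using (ℕ; zero; suc; _∸_; _≤_; _<_; _≡ᵇ_; _≤ᵇ_; _<ᵇ_)
open import Data.Bool using (Bool; true; false; T; _∧_; _∨_; not)
open import Data.List using (List; []; _∷_; length; filterᵇ; applyUpTo)
open import Data.Bool.ListAction using (any)
open import Data.List.Membership.Propositional using (_∈_)
open import Data.List.Relation.Unary.All using (All)
open import Data.List.Relation.Unary.Unique.Propositional using (Unique)
open import Data.Product using (_×_; _,_; ∃; Σ)
open import Data.Fin using (Fin; toℕ)
open import Relation.Binary.PropositionalEquality using (_≡_; _≢_)
open import Relation.Nullary using (¬_)
open import Function.Bundles using (_⇔_)

-- An arc (s₁ , s₂) with s₁ < s₂ (unordered pair stored in increasing order).
Arc : Set
Arc = ℕ × ℕ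

ValidArc : ℕ → Arc → Set
ValidArc n (a , b) = (1 ≤ a) × (a < b) × (b ≤ n) × (1 < b ∸ a) × (b ∸ a < n ∸ 1)

record Diagram (n : ℕ) : Set where
  field
    arcs     : List Arc
    distinct : Unique arcs
    valid    : All (ValidArc n) arcs
open Diagram public

supportsᵇ : ℕ → Arc → Bool
supportsᵇ s (a , b) = (s ≡ᵇ a) ∨ (s ≡ᵇ b)

Supports : ℕ → Arc → Set
Supports s x = T (supportsᵇ s x)

isFreeᵇ : ∀ {n} → Diagram n → ℕ → Bool
isFreeᵇ {n} S s = (1 ≤ᵇ s) ∧ ((s ≤ᵇ n) ∧ not (any (supportsᵇ s) (arcs S)))

Free : ∀ {n} → Diagram n → ℕ → Set
Free S s = T (isFreeᵇ S s)

Covers : Arc → ℕ → Set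
Covers (a , b) s = (a < s) × (s < b)

Binary : ∀ {n} → Diagram n → Set
Binary S = (arcs S ≢ []) ×
  (∀ (s : ℕ) {x y : Arc} → x ∈ arcs S → y ∈ arcs S → Supports s x → Supports s y → x ≡ y)

Proper : ∀ {n} → Diagram n → Set
Proper S = Binary S ×
  ((∀ {x} → x ∈ arcs S → ∃ λ s → Free S s × Covers x s) ×
   (∀ {x} → x ∈ arcs S → ¬ (∀ s → Free S s → Covers x s)))

Parallel : ∀ {n} → Diagram n → Arc → Arc → Set
Parallel S x y = ∀ s → Free S s → (Covers x s ⇔ Covers y s)

NoParallelArcs : ∀ {n} → Diagram n → Set
NoParallelArcs S = ∀ {x y} → x ∈ arcs S → y ∈ arcs S → x ≢ y → ¬ Parallel S x y

freeSites : ∀ {n} → Diagram n → List ℕ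
freeSites {n} S = filterᵇ (isFreeᵇ S) (applyUpTo suc n)

nfree : ∀ {n} → Diagram n → ℕ
nfree S = length (freeSites S)

-- 0-based block index of a site: s ∈ B_{k+1} iff exactly k free sites are < s
blockOf : ∀ {n} → Diagram n → ℕ → ℕ
blockOf S s = length (filterᵇ (λ u → u <ᵇ s) (freeSites S))

countᵇ : {A : Set} → (A → Bool) → List A → ℕ
countᵇ p xs = length (filterᵇ p xs)

-- entry (i , j) (0-based) of the block matrix B(S), of order nfree S + 1
blockEntry : ∀ {n} → Diagram n → ℕ → ℕ → ℕ
blockEntry S i j = countᵇ (λ { (a , b) →
    ((blockOf S a ≡ᵇ i) ∧ (blockOf S b ≡ᵇ j)) ∨ ((blockOf S a ≡ᵇ j) ∧ (blockOf S b ≡ᵇ i)) })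
  (arcs S)

Matrix : ℕ → Set
Matrix m = Fin m → Fin m → ℕ

BlockMatrixIs : ∀ {n m} → Diagram n → Matrix m → Set
BlockMatrixIs {m = m} S M =
  (m ≡ suc (nfree S)) × (∀ (i j : Fin m) → blockEntry S (toℕ i) (toℕ j) ≡ M i j)

SymmetricMatrix : ∀ {m} → Matrix m → Set
SymmetricMatrix M = ∀ i j → M i j ≡ M j i

IsZeroMatrix : ∀ {m} → Matrix m → Set
IsZeroMatrix M = ∀ i j → M i j ≡ 0

DiagonalZero : ∀ {m} → Matrix m → Set
DiagonalZero M = ∀ i → M i i ≡ 0

RainbowZero : ∀ {m} → Matrix m → Set
RainbowZero {m} M = ∀ (i j : Fin m) → toℕ i ≡ 0 → toℕ j ≡ m ∸ 1 → (M i j ≡ 0) × (M j i ≡ 0)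

ZeroOneMatrix : ∀ {m} → Matrix m → Set
ZeroOneMatrix M = ∀ i j → M i j ≤ 1

ProperlyRealizable : ∀ {m} → Matrix m → Set
ProperlyRealizable M = ∃ λ n → Σ (Diagram n) λ S → Proper S × BlockMatrixIs S M

-- Every arc of a proper diagram covers a free site, so its left endpoint lies in an earlier
-- block than its right one; hence no arc is counted on the diagonal of B(S).  An arc from the
-- first block to the last would cover every free site, so the rainbow entries vanish too.
-- Parallel arcs cover the same free sites, hence join the same two blocks, and together
-- contribute 2 to one entry of B(S); this is impossible for a (0,1)-matrix.
-- Conversely, a matrix with zero diagonal and rainbow entries is realised by laying out its
-- blocks separated by single free sites and joining, for b < c, M b c sites of block b to as
-- many sites of block c.  Each such arc covers the free site right after block b, and misses
-- the first free site (if b > 0) or the last one (if b = 0, since then c is not the last block).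

module Submission where

open import Defs
open import Data.Bool using (Bool; true; false; T; _∧_; _∨_; not; if_then_else_)
open import Data.Bool.Properties using (T-≡; T-∧; T-∨; ∨-comm; ∧-identityʳ)
open import Data.Bool.ListAction using (any)
open import Data.Empty using (⊥; ⊥-elim)
open import Data.Fin using (toℕ; fromℕ<)
open import Data.Fin.Properties using (toℕ-fromℕ<; toℕ<n; fromℕ<-toℕ)
open import Data.List using (List; []; _∷_; length; filterᵇ; applyUpTo; upTo; map; concatMap; _++_)
open import Data.List.Properties
  using (length-++; length-filter; filter-++; filter-all; filter-none; filter-some; filter-complete; length-applyUpTo)
open import Data.List.Membership.Propositional using (_∈_; lose; find)
open import Data.List.Membership.Propositional.Properties
  using (∈-filter⁺; ∈-filter⁻; ∈-applyUpTo⁺; ∈-applyUpTo⁻; ∈-upTo⁺; ∈-upTo⁻; ∈-map⁺; ∈-map⁻; ∈-concatMap⁺; ∈-concatMap⁻)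
import Data.List.Relation.Unary.All as All
import Data.List.Relation.Unary.All.Properties as All
open import Data.List.Relation.Binary.Disjoint.Propositional using (Disjoint)
open import Data.List.Relation.Unary.Any using (here; there)
open import Data.List.Relation.Unary.Any.Properties using (any⁺; any⁻)
open import Data.List.Relation.Unary.AllPairs using ([]; _∷_)
open import Data.List.Relation.Unary.Unique.Propositional using (Unique)
import Data.List.Relation.Unary.Unique.Propositional.Properties as Unique
open import Data.Nat using (ℕ; zero; suc; _+_; _∸_; _≤_; _<_; _≡ᵇ_; _≤ᵇ_; _<ᵇ_; z≤n; s≤s; z<s; s<s; _<?_; _≤?_; s≤s⁻¹)
open import Data.Nat.Properties
open import Data.Product using (_×_; _,_; ∃; proj₁; proj₂)
open import Data.Sum using (_⊎_; inj₁; inj₂)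
open import Function using (id; _∘_; case_of_; _⇔_; mk⇔; Equivalence)
open import Relation.Binary.Definitions using (tri<; tri≈; tri>)
open import Relation.Binary.PropositionalEquality
open import Relation.Nullary using (¬_; yes; no; contradiction)
open import Relation.Nullary.Decidable using (T?)

open Equivalence using (to; from)

-- Finite sums

∑< : ℕ → (ℕ → ℕ) → ℕ
∑< zero    g = 0
∑< (suc k) g = g 0 + ∑< k (g ∘ suc)

syntax ∑< k (λ i → e) = ∑[ i < k ] e

∑<-+ : ∀ k l g → ∑< (k + l) g ≡ ∑< k g + ∑[ i < l ] g (k + i)
∑<-+ zero    l g = refl
∑<-+ (suc k) l g = trans (cong (g 0 +_) (∑<-+ k l (g ∘ suc))) (sym (+-assoc (g 0) _ _))

∑<-suc : ∀ k g → ∑< (suc k) g ≡ ∑< k g + g k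
∑<-suc zero    g = +-identityʳ (g 0)
∑<-suc (suc k) g = trans (cong (g 0 +_) (∑<-suc k (g ∘ suc))) (sym (+-assoc (g 0) _ _))

∑<-cong : ∀ k {g h} → (∀ i → i < k → g i ≡ h i) → ∑< k g ≡ ∑< k h
∑<-cong zero    e = refl
∑<-cong (suc k) e = cong₂ _+_ (e 0 z<s) (∑<-cong k (λ i i<k → e (suc i) (s<s i<k)))

∑<-zero : ∀ k {g} → (∀ i → i < k → g i ≡ 0) → ∑< k g ≡ 0
∑<-zero zero    e = refl
∑<-zero (suc k) e = cong₂ _+_ (e 0 z<s) (∑<-zero k (λ i i<k → e (suc i) (s<s i<k)))

∑<-single : ∀ k {g} i → i < k → (∀ j → j ≢ i → g j ≡ 0) → ∑< k g ≡ g i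
∑<-single (suc k) {g} zero    _ e =
  trans (cong (g 0 +_) (∑<-zero k (λ j _ → e (suc j) λ ()))) (+-identityʳ (g 0))
∑<-single (suc k) {g} (suc i) (s<s i<k) e =
  cong₂ _+_ (e 0 λ ()) (∑<-single k i i<k (λ j j≢i → e (suc j) (j≢i ∘ suc-injective)))

∑<-const-1 : ∀ k → ∑[ i < k ] 1 ≡ k
∑<-const-1 zero    = refl
∑<-const-1 (suc k) = cong suc (∑<-const-1 k)

∑<-monoˡ-≤ : ∀ g {k k'} → k ≤ k' → ∑< k g ≤ ∑< k' g
∑<-monoˡ-≤ g z≤n       = z≤n
∑<-monoˡ-≤ g (s≤s k≤k') = +-monoʳ-≤ (g 0) (∑<-monoˡ-≤ (g ∘ suc) k≤k')

∑<-suc-≤ : ∀ g {k k'} → k < k' → ∑< k g + g k ≤ ∑< k' g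
∑<-suc-≤ g {k} {k'} k<k' = subst (_≤ ∑< k' g) (∑<-suc k g) (∑<-monoˡ-≤ g k<k')

∑<-decode : ∀ K g {x} → x < ∑< K g → ∃ λ k → k < K × ∑< k g ≤ x × x < ∑< k g + g k
∑<-decode zero    g ()
∑<-decode (suc K) g {x} x< with x <? ∑< K g
... | yes p = let k , k<K , lo , hi = ∑<-decode K g p in k , m<n⇒m<1+n k<K , lo , hi
... | no ¬p = K , ≤-refl , ≮⇒≥ ¬p , subst (x <_) (∑<-suc K g) x<

∑<-+-< : ∀ g {k k' t} t' → t < g k → k < k' → ∑< k g + t < ∑< k' g + t'
∑<-+-< g {k} t' t< k<k' = ≤-trans (+-monoʳ-< (∑< k g) t<) (≤-trans (∑<-suc-≤ g k<k') (m≤m+n _ t'))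

∑<-+-injective : ∀ g {k k' t t'} → t < g k → t' < g k' → ∑< k g + t ≡ ∑< k' g + t' → k ≡ k'
∑<-+-injective g {k} {k'} {t} {t'} t< t'< e with <-cmp k k'
... | tri< k<k' _ _ = contradiction e (<⇒≢ (∑<-+-< g t' t< k<k'))
... | tri≈ _ k≡k' _ = k≡k'
... | tri> _ _ k'<k = contradiction (sym e) (<⇒≢ (∑<-+-< g t t'< k'<k))

𝟙 : Bool → ℕ
𝟙 true  = 1
𝟙 false = 0

𝟙-true : ∀ {x} → T x → 𝟙 x ≡ 1
𝟙-true {true} _ = refl

𝟙-false : ∀ {x} → ¬ T x → 𝟙 x ≡ 0
𝟙-false {false} _  = refl
𝟙-false {true}  ¬t = contradiction _ ¬t

𝟙-mono : ∀ {x y} → (T x → T y) → 𝟙 x ≤ 𝟙 y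
𝟙-mono {false}         _ = z≤n
𝟙-mono {true} {true}   _ = ≤-refl
𝟙-mono {true} {false}  f = contradiction _ f

𝟙-cong : ∀ {x y} → T x ⇔ T y → 𝟙 x ≡ 𝟙 y
𝟙-cong x⇔y = ≤-antisym (𝟙-mono (to x⇔y)) (𝟙-mono (from x⇔y))

∑<-count-< : ∀ {k b} → b ≤ k → ∑[ i < k ] 𝟙 (i <ᵇ b) ≡ b
∑<-count-< {k}     {zero}  _         = ∑<-zero k λ _ _ → refl
∑<-count-< {suc k} {suc b} (s≤s b≤k) = cong suc (∑<-count-< b≤k)

Unique-map⁺-injectiveOn : ∀ {A B : Set} (f : A → B) {xs} → Unique xs →
  (∀ {x y} → x ∈ xs → y ∈ xs → f x ≡ f y → x ≡ y) → Unique (map f xs)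
Unique-map⁺-injectiveOn f {[]}     []         _   = []
Unique-map⁺-injectiveOn f {x ∷ xs} (x∉xs ∷ xs-unique) inj =
  All.map⁺ (All.tabulate λ y∈ fx≡fy → All.lookup x∉xs y∈ (inj (here refl) (there y∈) fx≡fy)) ∷
  Unique-map⁺-injectiveOn f xs-unique (λ x∈ y∈ → inj (there x∈) (there y∈))

Unique-concatMap⁺ : ∀ {A B : Set} {g : A → List B} (key : B → A) {xs} → Unique xs →
  (∀ x → Unique (g x)) → (∀ {x y} → y ∈ g x → key y ≡ x) → Unique (concatMap g xs)
Unique-concatMap⁺ key {[]}     []         _  _   = []
Unique-concatMap⁺ {g = g} key {x ∷ xs} (x∉xs ∷ xs-unique) g-unique key≡ =
  Unique.++⁺ (g-unique x) (Unique-concatMap⁺ key xs-unique g-unique key≡) disjoint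
  where
    disjoint : Disjoint (g x) (concatMap g xs)
    disjoint (y∈gx , y∈rest) =
      let x' , x'∈xs , y∈gx' = find (∈-concatMap⁻ g y∈rest)
      in All.lookup x∉xs x'∈xs (trans (sym (key≡ y∈gx)) (key≡ y∈gx'))

module _ {A : Set} (p : A → Bool) where

  countᵇ-∷ : ∀ x xs → countᵇ p (x ∷ xs) ≡ 𝟙 (p x) + countᵇ p xs
  countᵇ-∷ x xs with p x
  ... | true  = refl
  ... | false = refl

  countᵇ-++ : ∀ xs ys → countᵇ p (xs ++ ys) ≡ countᵇ p xs + countᵇ p ys
  countᵇ-++ xs ys = trans (cong length (filter-++ (T? ∘ p) xs ys)) (length-++ (filterᵇ p xs))

  countᵇ-applyUpTo : ∀ h k → countᵇ p (applyUpTo h k) ≡ ∑[ i < k ] 𝟙 (p (h i))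
  countᵇ-applyUpTo h zero    = refl
  countᵇ-applyUpTo h (suc k) =
    trans (countᵇ-∷ (h 0) _) (cong (𝟙 (p (h 0)) +_) (countᵇ-applyUpTo (h ∘ suc) k))

  countᵇ-concatMap : ∀ {B : Set} (g : B → List A) h k →
    countᵇ p (concatMap g (applyUpTo h k)) ≡ ∑[ i < k ] countᵇ p (g (h i))
  countᵇ-concatMap g h zero    = refl
  countᵇ-concatMap g h (suc k) =
    trans (countᵇ-++ (g (h 0)) _) (cong (countᵇ p (g (h 0)) +_) (countᵇ-concatMap g (h ∘ suc) k))

  countᵇ-none : ∀ xs → (∀ {x} → x ∈ xs → ¬ T (p x)) → countᵇ p xs ≡ 0
  countᵇ-none xs none = cong length (filter-none (T? ∘ p) (All.tabulate none))

  countᵇ-all : ∀ xs → (∀ {x} → x ∈ xs → T (p x)) → countᵇ p xs ≡ length xs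
  countᵇ-all xs every = cong length (filter-all (T? ∘ p) (All.tabulate every))

  countᵇ-two : ∀ {x y} xs → x ∈ xs → y ∈ xs → x ≢ y → T (p x) → T (p y) → 2 ≤ countᵇ p xs
  countᵇ-two (z ∷ zs) (here refl) (here refl) x≢y _ _  = contradiction refl x≢y
  countᵇ-two (z ∷ zs) (here refl) (there y∈) _ px py =
    subst (2 ≤_) (sym (countᵇ-∷ z zs)) (+-mono-≤ (≤-reflexive (sym (𝟙-true px))) (filter-some (T? ∘ p) (lose y∈ py)))
  countᵇ-two (z ∷ zs) (there x∈) (here refl) _ px py =
    subst (2 ≤_) (sym (countᵇ-∷ z zs)) (+-mono-≤ (≤-reflexive (sym (𝟙-true py))) (filter-some (T? ∘ p) (lose x∈ px)))
  countᵇ-two (z ∷ zs) (there x∈) (there y∈) x≢y px py =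
    ≤-trans (countᵇ-two zs x∈ y∈ x≢y px py) (subst (countᵇ p zs ≤_) (sym (countᵇ-∷ z zs)) (m≤n+m _ _))

module _ {A : Set} {p q : A → Bool} where

  countᵇ-cong : ∀ xs → (∀ {x} → x ∈ xs → T (p x) ⇔ T (q x)) → countᵇ p xs ≡ countᵇ q xs
  countᵇ-cong []       _ = refl
  countᵇ-cong (x ∷ xs) e = begin
    countᵇ p (x ∷ xs)           ≡⟨ countᵇ-∷ p x xs ⟩
    𝟙 (p x) + countᵇ p xs       ≡⟨ cong₂ _+_ (𝟙-cong (e (here refl))) (countᵇ-cong xs (e ∘ there)) ⟩
    𝟙 (q x) + countᵇ q xs       ≡⟨ countᵇ-∷ q x xs ⟨
    countᵇ q (x ∷ xs)           ∎
    where open ≡-Reasoning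

  countᵇ-mono-≤ : (∀ x → T (p x) → T (q x)) → ∀ xs → countᵇ p xs ≤ countᵇ q xs
  countᵇ-mono-≤ p⇒q []       = z≤n
  countᵇ-mono-≤ p⇒q (x ∷ xs) = subst₂ _≤_ (sym (countᵇ-∷ p x xs)) (sym (countᵇ-∷ q x xs))
    (+-mono-≤ (𝟙-mono (p⇒q x)) (countᵇ-mono-≤ p⇒q xs))

  countᵇ-mono-< : (∀ x → T (p x) → T (q x)) → ∀ {x} xs → x ∈ xs → ¬ T (p x) → T (q x) →
    countᵇ p xs < countᵇ q xs
  countᵇ-mono-< p⇒q (y ∷ ys) (here refl) ¬px qx = subst₂ _<_ (sym (countᵇ-∷ p y ys)) (sym (countᵇ-∷ q y ys))
    (+-mono-<-≤ (subst₂ _<_ (sym (𝟙-false ¬px)) (sym (𝟙-true qx)) z<s) (countᵇ-mono-≤ p⇒q ys))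
  countᵇ-mono-< p⇒q (y ∷ ys) (there x∈) ¬px qx = subst₂ _<_ (sym (countᵇ-∷ p y ys)) (sym (countᵇ-∷ q y ys))
    (+-mono-≤-< (𝟙-mono (p⇒q y)) (countᵇ-mono-< p⇒q ys x∈ ¬px qx))

countᵇ-filterᵇ : ∀ {A : Set} (q r : A → Bool) xs → countᵇ q (filterᵇ r xs) ≡ countᵇ (λ x → r x ∧ q x) xs
countᵇ-filterᵇ q r []       = refl
countᵇ-filterᵇ q r (x ∷ xs) with r x
... | false = countᵇ-filterᵇ q r xs
... | true with q x
...   | true  = cong suc (countᵇ-filterᵇ q r xs)
...   | false = countᵇ-filterᵇ q r xs

countᵇ-map : ∀ {A B : Set} (p : B → Bool) (h : A → B) xs → countᵇ p (map h xs) ≡ countᵇ (p ∘ h) xs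
countᵇ-map p h []       = refl
countᵇ-map p h (x ∷ xs) with p (h x)
... | true  = cong suc (countᵇ-map p h xs)
... | false = countᵇ-map p h xs

-- Blocks of a diagram

-- blockEntry S i j counts, by definition, the arcs (a , b) with matches i j (blockOf S a) (blockOf S b).
matches : ℕ → ℕ → ℕ → ℕ → Bool
matches i j x y = ((x ≡ᵇ i) ∧ (y ≡ᵇ j)) ∨ ((x ≡ᵇ j) ∧ (y ≡ᵇ i))

matches⁺ : ∀ {i j x y} → x ≡ i → y ≡ j → T (matches i j x y)
matches⁺ {i} {j} refl refl = from T-∨ (inj₁ (from T-∧ (≡⇒≡ᵇ i i refl , ≡⇒≡ᵇ j j refl)))

matches⁻ : ∀ {i j x y} → T (matches i j x y) → (x ≡ i × y ≡ j) ⊎ (x ≡ j × y ≡ i)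
matches⁻ {i} {j} {x} {y} t with to T-∨ t
... | inj₁ u = let p , q = to T-∧ u in inj₁ (≡ᵇ⇒≡ x i p , ≡ᵇ⇒≡ y j q)
... | inj₂ u = let p , q = to T-∧ u in inj₂ (≡ᵇ⇒≡ x j p , ≡ᵇ⇒≡ y i q)

matches-sym : ∀ i j x y → matches i j x y ≡ matches j i x y
matches-sym i j x y = ∨-comm ((x ≡ᵇ i) ∧ (y ≡ᵇ j)) _

Supports⁻ : ∀ {s a b} → Supports s (a , b) → s ≡ a ⊎ s ≡ b
Supports⁻ {s} {a} {b} sup with to (T-∨ {s ≡ᵇ a}) sup
... | inj₁ s≡ᵇa = inj₁ (≡ᵇ⇒≡ s a s≡ᵇa)
... | inj₂ s≡ᵇb = inj₂ (≡ᵇ⇒≡ s b s≡ᵇb)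

T-not⇒¬T : ∀ {b} → T (not b) → ¬ T b
T-not⇒¬T {true} ()

¬T⇒T-not : ∀ {b} → ¬ T b → T (not b)
¬T⇒T-not {false} _  = _
¬T⇒T-not {true}  ¬t = ¬t _

module _ {n : ℕ} (S : Diagram n) where

  Free⇒bounds : ∀ {s} → Free S s → 1 ≤ s × s ≤ n
  Free⇒bounds {s} fr = let lo , rest = to (T-∧ {1 ≤ᵇ s}) fr ; hi , _ = to (T-∧ {s ≤ᵇ n}) rest
                       in ≤ᵇ⇒≤ 1 s lo , ≤ᵇ⇒≤ s n hi

  Supports⇒¬Free : ∀ {s x} → x ∈ arcs S → Supports s x → ¬ Free S s
  Supports⇒¬Free {s} x∈ sup fr =
    T-not⇒¬T (proj₂ (to (T-∧ {s ≤ᵇ n}) (proj₂ (to (T-∧ {1 ≤ᵇ s}) fr)))) (any⁺ (supportsᵇ s) (lose x∈ sup))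

  Free-intro : ∀ {s} → 1 ≤ s → s ≤ n → (∀ {x} → x ∈ arcs S → ¬ Supports s x) → Free S s
  Free-intro {s} lo hi unsupported = from T-∧ (≤⇒≤ᵇ lo , from T-∧ (≤⇒≤ᵇ hi , ¬T⇒T-not supported))
    where
      supported : ¬ T (any (supportsᵇ s) (arcs S))
      supported t = let _ , x∈ , sup = find (any⁻ (supportsᵇ s) (arcs S) t) in unsupported x∈ sup

  left-endpoint-¬Free : ∀ {a b} → (a , b) ∈ arcs S → ¬ Free S a
  left-endpoint-¬Free {a} {b} x∈ = Supports⇒¬Free {a} x∈ (from (T-∨ {a ≡ᵇ a}) (inj₁ (≡⇒≡ᵇ a a refl)))

  right-endpoint-¬Free : ∀ {a b} → (a , b) ∈ arcs S → ¬ Free S b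
  right-endpoint-¬Free {a} {b} x∈ = Supports⇒¬Free {b} x∈ (from (T-∨ {b ≡ᵇ a}) (inj₂ (≡⇒≡ᵇ b b refl)))

  ∈-freeSites⁺ : ∀ {s} → Free S s → s ∈ freeSites S
  ∈-freeSites⁺ {zero}  fr = contradiction (proj₁ (Free⇒bounds {0} fr)) λ ()
  ∈-freeSites⁺ {suc s} fr = ∈-filter⁺ (T? ∘ isFreeᵇ S) (∈-applyUpTo⁺ suc (proj₂ (Free⇒bounds {suc s} fr))) fr

  ∈-freeSites⁻ : ∀ {s} → s ∈ freeSites S → Free S s
  ∈-freeSites⁻ s∈ = proj₂ (∈-filter⁻ (T? ∘ isFreeᵇ S) {xs = applyUpTo suc n} s∈)

  blockOf-< : ∀ {a b u} → Free S u → a < u → u < b → blockOf S a < blockOf S b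
  blockOf-< {a} {b} {u} fr a<u u<b =
    countᵇ-mono-< (λ v v<a → <⇒<ᵇ (<-trans (<ᵇ⇒< v a v<a) (<-trans a<u u<b))) (freeSites S)
      (∈-freeSites⁺ fr) (λ u<a → <-asym a<u (<ᵇ⇒< u a u<a)) (<⇒<ᵇ u<b)

  blockOf≤nfree : ∀ s → blockOf S s ≤ nfree S
  blockOf≤nfree s = length-filter (T? ∘ (_<ᵇ s)) (freeSites S)

  blockOf≡0⇒ : ∀ {a u} → blockOf S a ≡ 0 → Free S u → a ≤ u
  blockOf≡0⇒ {a} e fr = ≮⇒≥ λ u<a →
    <⇒≢ (filter-some (T? ∘ (_<ᵇ a)) (lose (∈-freeSites⁺ fr) (<⇒<ᵇ u<a))) (sym e)

  blockOf≡nfree⇒ : ∀ {b u} → blockOf S b ≡ nfree S → Free S u → u < b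
  blockOf≡nfree⇒ {b} {u} e fr = <ᵇ⇒< u b (proj₂ (∈-filter⁻ (T? ∘ (_<ᵇ b)) {xs = freeSites S} u∈))
    where
      u∈ : u ∈ filterᵇ (_<ᵇ b) (freeSites S)
      u∈ = subst (u ∈_) (sym (filter-complete (T? ∘ (_<ᵇ b)) e)) (∈-freeSites⁺ fr)

  blockOf-cong : ∀ {a c} → (∀ {u} → Free S u → u < a ⇔ u < c) → blockOf S a ≡ blockOf S c
  blockOf-cong {a} {c} e = countᵇ-cong (freeSites S) λ {u} u∈ →
    let u<a⇔u<c = e (∈-freeSites⁻ u∈) in
    mk⇔ (<⇒<ᵇ ∘ to u<a⇔u<c ∘ <ᵇ⇒< u a) (<⇒<ᵇ ∘ from u<a⇔u<c ∘ <ᵇ⇒< u c)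

  blockOf≡∑ : ∀ s → blockOf S s ≡ ∑[ i < n ] 𝟙 (isFreeᵇ S (suc i) ∧ (suc i <ᵇ s))
  blockOf≡∑ s = trans (countᵇ-filterᵇ (_<ᵇ s) (isFreeᵇ S) (applyUpTo suc n)) (countᵇ-applyUpTo _ suc n)

  nfree≡∑ : nfree S ≡ ∑[ i < n ] 𝟙 (isFreeᵇ S (suc i))
  nfree≡∑ = countᵇ-applyUpTo (isFreeᵇ S) suc n

  blockEntry-sym : ∀ i j → blockEntry S i j ≡ blockEntry S j i
  blockEntry-sym i j = countᵇ-cong (arcs S) λ {(a , b)} _ →
    let x = blockOf S a ; y = blockOf S b in
    subst (λ t → T (matches i j x y) ⇔ T t) (matches-sym i j x y) (mk⇔ id id)

  module _ (proper : Proper S) where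

    arc-blocks-< : ∀ {a b} → (a , b) ∈ arcs S → blockOf S a < blockOf S b
    arc-blocks-< x∈ = let _ , fr , a<u , u<b = proj₁ (proj₂ proper) x∈ in blockOf-< fr a<u u<b

    ¬arc-first-last : ∀ {a b} → (a , b) ∈ arcs S → blockOf S a ≡ 0 → blockOf S b ≡ nfree S → ⊥
    ¬arc-first-last x∈ a≡0 b≡f = proj₂ (proj₂ proper) x∈ λ u fr →
      ≤∧≢⇒< (blockOf≡0⇒ a≡0 fr) (λ a≡u → left-endpoint-¬Free x∈ (subst (Free S) (sym a≡u) fr)) ,
      blockOf≡nfree⇒ b≡f fr

    blockEntry-diagonal : ∀ i → blockEntry S i i ≡ 0
    blockEntry-diagonal i = countᵇ-none _ (arcs S) λ x∈ t → <⇒≢ (arc-blocks-< x∈) (same-block (matches⁻ t))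
      where
        same-block : ∀ {x y} → (x ≡ i × y ≡ i) ⊎ (x ≡ i × y ≡ i) → x ≡ y
        same-block (inj₁ (refl , refl)) = refl
        same-block (inj₂ (refl , refl)) = refl

    blockEntry-first-last : blockEntry S 0 (nfree S) ≡ 0
    blockEntry-first-last = countᵇ-none _ (arcs S) λ x∈ t → case matches⁻ t of λ where
      (inj₁ (a≡0 , b≡f)) → ¬arc-first-last x∈ a≡0 b≡f
      (inj₂ (a≡f , b≡0)) → <⇒≱ (arc-blocks-< x∈) (subst₂ _≤_ (sym b≡0) (sym a≡f) z≤n)

    FreeCovers⊆ : Arc → Arc → Set
    FreeCovers⊆ x y = ∀ u → Free S u → Covers x u → Covers y u

    free-before-left : ∀ {a b c d u} → (c , d) ∈ arcs S → a < d → FreeCovers⊆ (c , d) (a , b) →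
      Free S u → u < a → u < c
    free-before-left {a} {b} {c} {d} {u} y∈ a<d y⊆x fr u<a with u <? c
    ... | yes u<c = u<c
    ... | no  u≮c = contradiction (proj₁ (y⊆x u fr (c<u , <-trans u<a a<d))) (<-asym u<a)
      where
        c<u : c < u
        c<u = ≤∧≢⇒< (≮⇒≥ u≮c) λ c≡u → left-endpoint-¬Free y∈ (subst (Free S) (sym c≡u) fr)

    free-before-right : ∀ {a b c d u} → (c , d) ∈ arcs S → a < d → FreeCovers⊆ (a , b) (c , d) →
      Free S u → u < b → u < d
    free-before-right {a} {b} {c} {d} {u} y∈ a<d x⊆y fr u<b with u <? d
    ... | yes u<d = u<d
    ... | no  u≮d = contradiction (proj₂ (x⊆y u fr (<-trans a<d d<u , u<b))) (<-asym d<u)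
      where
        d<u : d < u
        d<u = ≤∧≢⇒< (≮⇒≥ u≮d) λ d≡u → right-endpoint-¬Free y∈ (subst (Free S) (sym d≡u) fr)

    parallel⇒same-blocks : ∀ {a b c d} → (a , b) ∈ arcs S → (c , d) ∈ arcs S → Parallel S (a , b) (c , d) →
      blockOf S a ≡ blockOf S c × blockOf S b ≡ blockOf S d
    parallel⇒same-blocks x∈ y∈ par with proj₁ (proj₂ proper) x∈
    ... | s , fr , a<s , s<b =
      blockOf-cong (λ fr → mk⇔ (free-before-left y∈ a<d y⊆x fr) (free-before-left x∈ c<b x⊆y fr)) ,
      blockOf-cong (λ fr → mk⇔ (free-before-right y∈ a<d x⊆y fr) (free-before-right x∈ c<b y⊆x fr))
      where
        x⊆y = λ u fr → to (par u fr)
        y⊆x = λ u fr → from (par u fr)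
        c<s×s<d = x⊆y s fr (a<s , s<b)
        a<d = <-trans a<s (proj₂ c<s×s<d)
        c<b = <-trans (proj₁ c<s×s<d) s<b

module _ {n m : ℕ} (S : Diagram n) {M : Matrix m} (S↦M : BlockMatrixIs S M) where

  proper⇒diagonal-rainbow-zero : Proper S → DiagonalZero M × RainbowZero M
  proper⇒diagonal-rainbow-zero proper = diagonal , rainbow
    where
      diagonal : DiagonalZero M
      diagonal i = trans (sym (proj₂ S↦M i i)) (blockEntry-diagonal S proper (toℕ i))
      rainbow : RainbowZero M
      rainbow i j i≡0 j≡m-1 =
        trans (sym (proj₂ S↦M i j)) first-last ,
        trans (sym (proj₂ S↦M j i)) (trans (blockEntry-sym S _ _) first-last)
        where
          first-last : blockEntry S (toℕ i) (toℕ j) ≡ 0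
          first-last = subst₂ (λ x y → blockEntry S x y ≡ 0)
            (sym i≡0) (sym (trans j≡m-1 (cong (_∸ 1) (proj₁ S↦M)))) (blockEntry-first-last S proper)

  blockEntry≤1 : ZeroOneMatrix M → ∀ {i j} → i ≤ nfree S → j ≤ nfree S → blockEntry S i j ≤ 1
  blockEntry≤1 zeroOne {i} {j} i≤f j≤f =
    subst₂ (λ x y → blockEntry S x y ≤ 1) (toℕ-fromℕ< (<m i≤f)) (toℕ-fromℕ< (<m j≤f))
      (≤-trans (≤-reflexive (proj₂ S↦M _ _)) (zeroOne _ _))
    where
      <m : ∀ {k} → k ≤ nfree S → k < m
      <m {k} k≤f = subst (k <_) (sym (proj₁ S↦M)) (s≤s k≤f)

  proper-zero-one⇒no-parallel-arcs : Proper S → ZeroOneMatrix M → NoParallelArcs S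
  proper-zero-one⇒no-parallel-arcs proper zeroOne {a , b} {c , d} x∈ y∈ x≢y par =
    contradiction (≤-trans two (blockEntry≤1 zeroOne (blockOf≤nfree S a) (blockOf≤nfree S b))) λ { (s≤s ()) }
    where
      same = parallel⇒same-blocks S proper x∈ y∈ par
      i = blockOf S a
      j = blockOf S b
      two : 2 ≤ blockEntry S i j
      two = countᵇ-two _ (arcs S) x∈ y∈ x≢y (matches⁺ {i} {j} refl refl)
        (matches⁺ {i} {j} (sym (proj₁ same)) (sym (proj₂ same)))

-- Realising a matrix

∸<∸1 : ∀ {a d k} → 1 ≤ a → a < d → d ≤ k → 2 ≤ a ⊎ d < k → d ∸ a < k ∸ 1
∸<∸1 {suc zero}    _ _             _         (inj₁ (s≤s ()))
∸<∸1 {suc (suc a)} _ (s≤s (s≤s _)) (s≤s d<k) (inj₁ _)         = ≤-trans (s≤s (m∸n≤m _ a)) d<k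
∸<∸1 {suc a}       _ (s≤s _)       _         (inj₂ (s≤s d<k)) = ≤-trans (s≤s (m∸n≤m _ a)) d<k

-- Block b occupies the sites start b + 1, …, start b + rowSum b and, for b < f, is followed by
-- the free site start (suc b).  Within block b the A b c sites joined to block c come in
-- increasing order of c; the slot (b , c , t) is the t-th of them, at site b c t, and it is
-- joined to the slot (c , b , t).  A is a matrix of order suc f; its other values are unused.
module Construction (f : ℕ) (A : ℕ → ℕ → ℕ)
  (A-sym : ∀ i j → A i j ≡ A j i) (A-diagonal : ∀ i → A i i ≡ 0) (A-first-last : A 0 f ≡ 0) where

  m : ℕ
  m = suc f

  rowSum : ℕ → ℕ
  rowSum b = ∑[ c < m ] A b c

  start : ℕ → ℕ
  start b = ∑[ k < b ] suc (rowSum k)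

  offset : ℕ → ℕ → ℕ
  offset b c = ∑[ k < c ] A b k

  site : ℕ → ℕ → ℕ → ℕ
  site b c t = suc (start b + (offset b c + t))

  n : ℕ
  n = start f + rowSum f

  start-suc : ∀ b → start (suc b) ≡ suc (start b + rowSum b)
  start-suc b = trans (∑<-suc b (suc ∘ rowSum)) (+-suc (start b) (rowSum b))

  start-mono-≤ : ∀ {k k'} → k ≤ k' → start k ≤ start k'
  start-mono-≤ = ∑<-monoˡ-≤ (suc ∘ rowSum)

  start-suc-≤ : ∀ {k k'} → k < k' → start (suc k) ≤ start k'
  start-suc-≤ = start-mono-≤

  block-end≤n : ∀ {k} → k ≤ f → start k + rowSum k ≤ n
  block-end≤n {k} k≤f with m≤n⇒m<n∨m≡n k≤f
  ... | inj₂ refl = ≤-refl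
  ... | inj₁ k<f  = ≤-trans (n≤1+n _) (subst (_≤ n) (start-suc k) (≤-trans (start-suc-≤ k<f) (m≤m+n _ _)))

  Slot : Set
  Slot = ℕ × ℕ × ℕ

  Valid : Slot → Set
  Valid (b , c , t) = b < m × c < m × t < A b c

  siteOf : Slot → ℕ
  siteOf (b , c , t) = site b c t

  swap : Slot → Slot
  swap (b , c , t) = c , b , t

  Valid-swap : ∀ {x} → Valid x → Valid (swap x)
  Valid-swap {b , c , t} (b<m , c<m , t<) = c<m , b<m , subst (t <_) (A-sym b c) t<

  Valid⇒≢ : ∀ {b c t} → Valid (b , c , t) → b ≢ c
  Valid⇒≢ {b} (_ , _ , t<) refl = contradiction (subst (_ <_) (A-diagonal b) t<) λ ()

  offset+t<rowSum : ∀ {b c t} → c < m → t < A b c → offset b c + t < rowSum b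
  offset+t<rowSum {b} {c} c<m t< = ≤-trans (+-monoʳ-< (offset b c) t<) (∑<-suc-≤ (A b) c<m)

  start<site : ∀ b c t → start b < site b c t
  start<site b c t = s≤s (m≤m+n _ _)

  site≤block-end : ∀ {b c t} → Valid (b , c , t) → site b c t ≤ start b + rowSum b
  site≤block-end {b} (_ , c<m , t<) = +-monoʳ-< (start b) (offset+t<rowSum c<m t<)

  site<start-suc : ∀ {b c t} → Valid (b , c , t) → site b c t < start (suc b)
  site<start-suc {b} {c} {t} v = subst (site b c t <_) (sym (start-suc b)) (s≤s (site≤block-end v))

  site≢start-suc : ∀ {x} → Valid x → ∀ k → siteOf x ≢ start (suc k)
  site≢start-suc {b , c , t} v k e with b ≤? k
  ... | yes b≤k = <-irrefl e (≤-trans (site<start-suc v) (start-mono-≤ {suc b} (s≤s b≤k)))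
  ... | no  b≰k = <-irrefl (sym e) (≤-trans (s≤s (start-mono-≤ (≰⇒> b≰k))) (start<site b c t))

  start-suc<site⇔ : ∀ {b c t} → Valid (b , c , t) → ∀ k → start (suc k) < site b c t ⇔ k < b
  start-suc<site⇔ {b} {c} {t} v k = mk⇔
    (λ sep<s → ≰⇒> λ b≤k → <-asym sep<s (≤-trans (site<start-suc v) (start-mono-≤ {suc b} (s≤s b≤k))))
    (λ k<b → ≤-trans (s≤s (start-suc-≤ k<b)) (start<site b c t))

  site-injective : ∀ {x y} → Valid x → Valid y → siteOf x ≡ siteOf y → x ≡ y
  site-injective {b , c , t} {b' , c' , t'} (_ , c<m , t<) (_ , c'<m , t'<) e
    with refl ← ∑<-+-injective (suc ∘ rowSum) (s≤s (<⇒≤ (offset+t<rowSum c<m t<)))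
                  (s≤s (<⇒≤ (offset+t<rowSum c'<m t'<))) (suc-injective e)
    with e' ← +-cancelˡ-≡ (start b) _ _ (suc-injective e)
    with refl ← ∑<-+-injective (A b) t< t'< e'
    with refl ← +-cancelˡ-≡ (offset b c) _ _ e'
    = refl

  cell : ℕ → ℕ → List Slot
  cell b c = if b <ᵇ c then applyUpTo (λ t → b , c , t) (A b c) else []

  slots : List Slot
  slots = concatMap (λ b → concatMap (cell b) (upTo m)) (upTo m)

  ∈-cell⁻ : ∀ {b c x} → x ∈ cell b c → ∃ λ t → x ≡ (b , c , t) × b < c × t < A b c
  ∈-cell⁻ {b} {c} x∈ with b <ᵇ c in b<ᵇc
  ... | true  = let t , t< , x≡ = ∈-applyUpTo⁻ (λ t → b , c , t) x∈
                in t , x≡ , <ᵇ⇒< b c (subst T (sym b<ᵇc) _) , t<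

  ∈-slots⁻ : ∀ {b c t} → (b , c , t) ∈ slots → b < c × Valid (b , c , t)
  ∈-slots⁻ x∈ with b , b∈ , x∈row ← find (∈-concatMap⁻ _ x∈)
             with c , c∈ , x∈cell ← find (∈-concatMap⁻ (cell b) x∈row)
             with t , refl , b<c , t< ← ∈-cell⁻ x∈cell
    = b<c , ∈-upTo⁻ b∈ , ∈-upTo⁻ c∈ , t<

  ∈-slots⁺ : ∀ {b c t} → b < c → Valid (b , c , t) → (b , c , t) ∈ slots
  ∈-slots⁺ {b} {c} {t} b<c (b<m , c<m , t<) =
    ∈-concatMap⁺ _ (lose (∈-upTo⁺ b<m) (∈-concatMap⁺ (cell b) (lose (∈-upTo⁺ c<m) x∈cell)))
    where
      x∈cell : (b , c , t) ∈ cell b c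
      x∈cell rewrite to T-≡ (<⇒<ᵇ b<c) = ∈-applyUpTo⁺ (λ t → b , c , t) t<

  slots-unique : Unique slots
  slots-unique = Unique-concatMap⁺ proj₁ (Unique.upTo⁺ m)
    (λ b → Unique-concatMap⁺ (proj₁ ∘ proj₂) (Unique.upTo⁺ m) (cell-unique b) (cell-key b))
    (λ {b} x∈ → let c , _ , x∈cell = find (∈-concatMap⁻ (cell b) {xs = upTo m} x∈)
                in cong proj₁ (proj₁ (proj₂ (∈-cell⁻ x∈cell))))
    where
      cell-unique : ∀ b c → Unique (cell b c)
      cell-unique b c with b <ᵇ c
      ... | true  = Unique.applyUpTo⁺₁ _ (A b c) λ t<t' _ e → <⇒≢ t<t' (cong (proj₂ ∘ proj₂) e)
      ... | false = []
      cell-key : ∀ b {c x} → x ∈ cell b c → proj₁ (proj₂ x) ≡ c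
      cell-key b x∈ = cong (proj₁ ∘ proj₂) (proj₁ (proj₂ (∈-cell⁻ x∈)))

  arc : Slot → Arc
  arc x = siteOf x , siteOf (swap x)

  Supports-arc⁻ : ∀ {x s} → Supports s (arc x) → siteOf x ≡ s ⊎ siteOf (swap x) ≡ s
  Supports-arc⁻ {x} {s} sup with Supports⁻ {s} {siteOf x} {siteOf (swap x)} sup
  ... | inj₁ e = inj₁ (sym e)
  ... | inj₂ e = inj₂ (sym e)

  arc-injective : ∀ {x y} → x ∈ slots → y ∈ slots → arc x ≡ arc y → x ≡ y
  arc-injective x∈ y∈ e = site-injective (proj₂ (∈-slots⁻ x∈)) (proj₂ (∈-slots⁻ y∈)) (cong proj₁ e)

  first-block-partner<f : ∀ {c t} → Valid (0 , c , t) → c < f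
  first-block-partner<f {c} {t} (_ , c<m , t<) =
    ≤∧≢⇒< (s≤s⁻¹ c<m) λ { refl → contradiction (subst (t <_) A-first-last t<) λ () }

  arc-avoids-an-end : ∀ {b c t} → b < c → Valid (b , c , t) → 2 ≤ site b c t ⊎ site c b t < n
  arc-avoids-an-end {suc b} _ _ = inj₁ (s≤s (s≤s z≤n))
  arc-avoids-an-end {zero}  _ v = inj₂ (≤-trans (site<start-suc (Valid-swap v))
    (≤-trans (start-suc-≤ (first-block-partner<f v)) (m≤m+n _ _)))

  arc-valid : ∀ {x} → x ∈ slots → ValidArc n (arc x)
  arc-valid {b , c , t} x∈ with b<c , v ← ∈-slots⁻ x∈ =
    s≤s z≤n , ≤-trans (n≤1+n _) gap , d≤n , m+n≤o⇒m≤o∸n 2 gap ,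
    ∸<∸1 (s≤s z≤n) (≤-trans (n≤1+n _) gap) d≤n (arc-avoids-an-end b<c v)
    where
      a = site b c t
      d = site c b t
      gap : 2 + a ≤ d
      gap = ≤-trans (s≤s (≤-trans (site<start-suc v) (start-suc-≤ b<c))) (start<site c b t)
      d≤n : d ≤ n
      d≤n = ≤-trans (site≤block-end (Valid-swap v)) (block-end≤n (s≤s⁻¹ (proj₁ (proj₂ v))))

  diagram : Diagram n
  diagram = record
    { arcs     = map arc slots
    ; distinct = Unique-map⁺-injectiveOn arc slots-unique arc-injective
    ; valid    = All.map⁺ (All.tabulate arc-valid)
    }

  Valid⇒¬Free : ∀ {x} → Valid x → ¬ Free diagram (siteOf x)
  Valid⇒¬Free {b , c , t} v with <-cmp b c
  ... | tri< b<c _ _ = left-endpoint-¬Free diagram (∈-map⁺ arc (∈-slots⁺ b<c v))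
  ... | tri≈ _ b≡c _ = contradiction b≡c (Valid⇒≢ v)
  ... | tri> _ _ c<b = right-endpoint-¬Free diagram (∈-map⁺ arc (∈-slots⁺ c<b (Valid-swap v)))

  block-site-¬Free : ∀ {b i} → b < m → i < rowSum b → ¬ Free diagram (suc (start b + i))
  block-site-¬Free {b} {i} b<m i< with c , c<m , lo , hi ← ∑<-decode m (A b) i<
    with e ← m+[n∸m]≡n lo =
    subst (¬_ ∘ Free diagram) (cong (λ j → suc (start b + j)) e)
      (Valid⇒¬Free (b<m , c<m , +-cancelˡ-< (offset b c) _ _ (subst (_< offset b c + A b c) (sym e) hi)))

  separator-Free : ∀ {k} → 0 < k → k ≤ f → Free diagram (start k)
  separator-Free {suc k} _ k≤f =
    Free-intro diagram (s≤s z≤n) (≤-trans (start-mono-≤ k≤f) (m≤m+n _ _)) unsupported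
    where
      unsupported : ∀ {y} → y ∈ arcs diagram → ¬ Supports (start (suc k)) y
      unsupported y∈ sup with x , x∈ , refl ← ∈-map⁻ arc y∈ with _ , v ← ∈-slots⁻ x∈ | Supports-arc⁻ {x} sup
      ... | inj₁ e = site≢start-suc v k e
      ... | inj₂ e = site≢start-suc (Valid-swap v) k e

  ∑<-start : ∀ b g → ∑< (start b) g ≡ ∑[ k < b ] (∑[ i < rowSum k ] g (start k + i) + g (start k + rowSum k))
  ∑<-start zero    g = refl
  ∑<-start (suc b) g = begin
    ∑< (start (suc b)) g                                       ≡⟨ cong (λ z → ∑< z g) (∑<-suc b (suc ∘ rowSum)) ⟩
    ∑< (start b + suc (rowSum b)) g                            ≡⟨ ∑<-+ (start b) (suc (rowSum b)) g ⟩
    ∑< (start b) g + ∑[ i < suc (rowSum b) ] g (start b + i)   ≡⟨ cong₂ _+_ (∑<-start b g) (∑<-suc (rowSum b) _) ⟩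
    ∑< b block + block b                                       ≡⟨ ∑<-suc b block ⟨
    ∑< (suc b) block                                           ∎
    where
      open ≡-Reasoning
      block = λ k → ∑[ i < rowSum k ] g (start k + i) + g (start k + rowSum k)

  ∑-free-sites : ∀ (q : ℕ → Bool) →
    ∑[ i < n ] 𝟙 (isFreeᵇ diagram (suc i) ∧ q (suc i)) ≡ ∑[ k < f ] 𝟙 (q (start (suc k)))
  ∑-free-sites q = begin
    ∑< n G
      ≡⟨ ∑<-+ (start f) (rowSum f) G ⟩
    ∑< (start f) G + ∑[ i < rowSum f ] G (start f + i)
      ≡⟨ cong₂ _+_ (∑<-start f G) (∑<-zero (rowSum f) (inside ≤-refl)) ⟩
    ∑[ k < f ] (∑[ i < rowSum k ] G (start k + i) + G (start k + rowSum k)) + 0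
      ≡⟨ +-identityʳ _ ⟩
    ∑[ k < f ] (∑[ i < rowSum k ] G (start k + i) + G (start k + rowSum k))
      ≡⟨ ∑<-cong f (λ k k<f → cong₂ _+_ (∑<-zero (rowSum k) (inside (<⇒≤ k<f))) (separator k<f)) ⟩
    ∑[ k < f ] 𝟙 (q (start (suc k)))
      ∎
    where
      open ≡-Reasoning
      G = λ i → 𝟙 (isFreeᵇ diagram (suc i) ∧ q (suc i))
      inside : ∀ {k} → k ≤ f → ∀ i → i < rowSum k → G (start k + i) ≡ 0
      inside k≤f i i< = 𝟙-false λ t → block-site-¬Free (s≤s k≤f) i< (proj₁ (to T-∧ t))
      separator : ∀ {k} → k < f → G (start k + rowSum k) ≡ 𝟙 (q (start (suc k)))
      separator {k} k<f = subst (λ s → 𝟙 (isFreeᵇ diagram s ∧ q s) ≡ 𝟙 (q (start (suc k)))) (start-suc k)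
        (𝟙-cong (mk⇔ (proj₂ ∘ to (T-∧ {isFreeᵇ diagram (start (suc k))}))
                     (λ qs → from T-∧ (separator-Free (s≤s z≤n) k<f , qs))))

  blockOf-site : ∀ {x} → Valid x → blockOf diagram (siteOf x) ≡ proj₁ x
  blockOf-site {b , c , t} v@(b<m , _) = begin
    blockOf diagram s                                     ≡⟨ blockOf≡∑ diagram s ⟩
    ∑[ i < n ] 𝟙 (isFreeᵇ diagram (suc i) ∧ (suc i <ᵇ s)) ≡⟨ ∑-free-sites (_<ᵇ s) ⟩
    ∑[ k < f ] 𝟙 (start (suc k) <ᵇ s)                     ≡⟨ ∑<-cong f (λ k _ → 𝟙-cong (separator<site⇔ k)) ⟩
    ∑[ k < f ] 𝟙 (k <ᵇ b)                                 ≡⟨ ∑<-count-< (s≤s⁻¹ b<m) ⟩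
    b                                                     ∎
    where
      open ≡-Reasoning
      s = site b c t
      separator<site⇔ : ∀ k → T (start (suc k) <ᵇ s) ⇔ T (k <ᵇ b)
      separator<site⇔ k = let sep<s⇔k<b = start-suc<site⇔ v k in
        mk⇔ (<⇒<ᵇ ∘ to sep<s⇔k<b ∘ <ᵇ⇒< (start (suc k)) s) (<⇒<ᵇ ∘ from sep<s⇔k<b ∘ <ᵇ⇒< k b)

  nfree-diagram : nfree diagram ≡ f
  nfree-diagram = begin
    nfree diagram                                     ≡⟨ nfree≡∑ diagram ⟩
    ∑[ i < n ] 𝟙 (isFreeᵇ diagram (suc i))            ≡⟨ ∑<-cong n (λ i _ → cong 𝟙 (sym (∧-identityʳ _))) ⟩
    ∑[ i < n ] 𝟙 (isFreeᵇ diagram (suc i) ∧ true)     ≡⟨ ∑-free-sites (λ _ → true) ⟩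
    ∑[ k < f ] 1                                      ≡⟨ ∑<-const-1 f ⟩
    f                                                 ∎
    where open ≡-Reasoning

  pairWeight : ℕ → ℕ → ℕ → ℕ → ℕ
  pairWeight i j b c = if (b <ᵇ c) ∧ matches i j b c then A b c else 0

  pairWeight-zero : ∀ i j b c → (b < c → (b ≡ i × c ≡ j) ⊎ (b ≡ j × c ≡ i) → ⊥) → pairWeight i j b c ≡ 0
  pairWeight-zero i j b c h with (b <ᵇ c) ∧ matches i j b c in eq
  ... | false = refl
  ... | true  = let b<c , match = to (T-∧ {b <ᵇ c}) (subst T (sym eq) _)
                in ⊥-elim (h (<ᵇ⇒< b c b<c) (matches⁻ {i} {j} {b} {c} match))

  pairWeight-sym : ∀ i j b c → pairWeight i j b c ≡ pairWeight j i b c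
  pairWeight-sym i j b c = cong (λ w → if (b <ᵇ c) ∧ w then A b c else 0) (matches-sym i j b c)

  pairWeight-diagonal : ∀ i b c → pairWeight i i b c ≡ 0
  pairWeight-diagonal i b c = pairWeight-zero i i b c λ where
    b<c (inj₁ (refl , refl)) → <-irrefl refl b<c
    b<c (inj₂ (refl , refl)) → <-irrefl refl b<c

  pairWeight-self : ∀ {i j} → i < j → pairWeight i j i j ≡ A i j
  pairWeight-self {i} {j} i<j rewrite to T-≡ (<⇒<ᵇ i<j) | to T-≡ (matches⁺ {i} {j} refl refl) = refl

  ∑∑pairWeight-< : ∀ {i j} → i < j → j < m → ∑[ b < m ] ∑[ c < m ] pairWeight i j b c ≡ A i j
  ∑∑pairWeight-< {i} {j} i<j j<m = begin
    ∑[ b < m ] ∑[ c < m ] pairWeight i j b c ≡⟨ ∑<-single m i (<-trans i<j j<m) other-row ⟩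
    ∑[ c < m ] pairWeight i j i c            ≡⟨ ∑<-single m j j<m other-column ⟩
    pairWeight i j i j                       ≡⟨ pairWeight-self i<j ⟩
    A i j                                    ∎
    where
      open ≡-Reasoning
      other-row : ∀ b → b ≢ i → ∑[ c < m ] pairWeight i j b c ≡ 0
      other-row b b≢i = ∑<-zero m λ c _ → pairWeight-zero i j b c λ where
        _   (inj₁ (b≡i , _))    → b≢i b≡i
        b<c (inj₂ (refl , refl)) → <-asym b<c i<j
      other-column : ∀ c → c ≢ j → pairWeight i j i c ≡ 0
      other-column c c≢j = pairWeight-zero i j i c λ where
        _ (inj₁ (_ , c≡j)) → c≢j c≡j
        _ (inj₂ (i≡j , _)) → <-irrefl i≡j i<j

  ∑∑pairWeight : ∀ {i j} → i < m → j < m → ∑[ b < m ] ∑[ c < m ] pairWeight i j b c ≡ A i j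
  ∑∑pairWeight {i} {j} i<m j<m with <-cmp i j
  ... | tri< i<j _ _ = ∑∑pairWeight-< i<j j<m
  ... | tri≈ _ refl _ = trans (∑<-zero m λ b _ → ∑<-zero m λ c _ → pairWeight-diagonal i b c) (sym (A-diagonal i))
  ... | tri> _ _ j<i = trans (∑<-cong m λ b _ → ∑<-cong m λ c _ → pairWeight-sym i j b c)
                             (trans (∑∑pairWeight-< j<i i<m) (A-sym j i))

  cell-matches : ∀ i j {b c x} → b < m → c < m → x ∈ applyUpTo (λ t → b , c , t) (A b c) →
    matches i j (blockOf diagram (siteOf x)) (blockOf diagram (siteOf (swap x))) ≡ matches i j b c
  cell-matches i j b<m c<m x∈ with t , t< , refl ← ∈-applyUpTo⁻ _ x∈ =
    cong₂ (matches i j) (blockOf-site (b<m , c<m , t<)) (blockOf-site (Valid-swap (b<m , c<m , t<)))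

  count-cell : ∀ i j {b c} → b < m → c < m →
    countᵇ (λ x → matches i j (blockOf diagram (siteOf x)) (blockOf diagram (siteOf (swap x))))
      (if b <ᵇ c then applyUpTo (λ t → b , c , t) (A b c) else [])
      ≡ pairWeight i j b c
  count-cell i j {b} {c} b<m c<m with b <ᵇ c | matches i j b c in match
  ... | false | _     = refl
  ... | true  | true  =
    trans (countᵇ-all _ _ λ x∈ → subst T (sym (trans (cell-matches i j b<m c<m x∈) match)) _)
          (length-applyUpTo _ (A b c))
  ... | true  | false =
    countᵇ-none _ _ λ x∈ → subst (¬_ ∘ T) (sym (trans (cell-matches i j b<m c<m x∈) match)) λ ()

  blockEntry-diagram : ∀ {i j} → i < m → j < m → blockEntry diagram i j ≡ A i j
  blockEntry-diagram {i} {j} i<m j<m = begin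
    blockEntry diagram i j
      ≡⟨ countᵇ-map P arc slots ⟩
    countᵇ (P ∘ arc) slots
      ≡⟨ countᵇ-concatMap (P ∘ arc) (λ b → concatMap (cell b) (upTo m)) id m ⟩
    ∑[ b < m ] countᵇ (P ∘ arc) (concatMap (cell b) (upTo m))
      ≡⟨ ∑<-cong m (λ b b<m → trans (countᵇ-concatMap (P ∘ arc) (cell b) id m)
                                    (∑<-cong m λ c c<m → count-cell i j b<m c<m)) ⟩
    ∑[ b < m ] ∑[ c < m ] pairWeight i j b c
      ≡⟨ ∑∑pairWeight i<m j<m ⟩
    A i j
      ∎
    where
      open ≡-Reasoning
      P : Arc → Bool
      P (a , b) = matches i j (blockOf diagram a) (blockOf diagram b)

  slot≢swap : ∀ {x y} → x ∈ slots → y ∈ slots → x ≢ swap y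
  slot≢swap {b , c , t} x∈ y∈ refl = <-asym (proj₁ (∈-slots⁻ x∈)) (proj₁ (∈-slots⁻ y∈))

  Supports-both⇒≡ : ∀ s {x y} → x ∈ slots → y ∈ slots → Supports s (arc x) → Supports s (arc y) → x ≡ y
  Supports-both⇒≡ s {x} {y} x∈ y∈ sx sy
    with _ , vx ← ∈-slots⁻ x∈ | _ , vy ← ∈-slots⁻ y∈ | Supports-arc⁻ {x} {s} sx | Supports-arc⁻ {y} {s} sy
  ... | inj₁ ex | inj₁ ey = site-injective vx vy (trans ex (sym ey))
  ... | inj₂ ex | inj₂ ey = cong swap (site-injective (Valid-swap vx) (Valid-swap vy) (trans ex (sym ey)))
  ... | inj₁ ex | inj₂ ey = contradiction (site-injective vx (Valid-swap vy) (trans ex (sym ey))) (slot≢swap x∈ y∈)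
  ... | inj₂ ex | inj₁ ey = contradiction (site-injective vy (Valid-swap vx) (trans ey (sym ex))) (slot≢swap y∈ x∈)

  arc-covers-separator : ∀ {x} → x ∈ slots → ∃ λ s → Free diagram s × Covers (arc x) s
  arc-covers-separator {b , c , t} x∈ with b<c , v@(_ , c<m , _) ← ∈-slots⁻ x∈ =
    start (suc b) , separator-Free (s≤s z≤n) (≤-trans b<c (s≤s⁻¹ c<m)) ,
    site<start-suc v , ≤-trans (s≤s (start-suc-≤ b<c)) (start<site c b t)

  arc-misses-free-site : ∀ {x} → x ∈ slots → ¬ (∀ s → Free diagram s → Covers (arc x) s)
  arc-misses-free-site {zero , c , t} x∈ covers-all =
    <-asym (proj₂ (covers-all (start f) (separator-Free (≤-trans (s≤s z≤n) c<f) ≤-refl)))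
           (≤-trans (site<start-suc (Valid-swap v)) (start-suc-≤ c<f))
    where
      v = proj₂ (∈-slots⁻ x∈)
      c<f = first-block-partner<f v
  arc-misses-free-site {suc b , c , t} x∈ covers-all =
    <-asym (proj₁ (covers-all (start 1) (separator-Free (s≤s z≤n) (≤-trans (s≤s z≤n) (≤-trans b<c (s≤s⁻¹ c<m))))))
           (≤-trans (s≤s (start-mono-≤ {1} {suc b} (s≤s z≤n))) (start<site (suc b) c t))
    where
      b<c = proj₁ (∈-slots⁻ x∈)
      c<m = proj₁ (proj₂ (proj₂ (∈-slots⁻ x∈)))

  diagram-proper : arcs diagram ≢ [] → Proper diagram
  diagram-proper nonempty = (nonempty , binary) , covers , misses
    where
      binary : ∀ s {y y'} → y ∈ arcs diagram → y' ∈ arcs diagram → Supports s y → Supports s y' → y ≡ y'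
      binary s y∈ y'∈ sy sy' with x , x∈ , refl ← ∈-map⁻ arc y∈ | x' , x'∈ , refl ← ∈-map⁻ arc y'∈ =
        cong arc (Supports-both⇒≡ s x∈ x'∈ sy sy')
      covers : ∀ {y} → y ∈ arcs diagram → ∃ λ s → Free diagram s × Covers y s
      covers y∈ with x , x∈ , refl ← ∈-map⁻ arc y∈ = arc-covers-separator x∈
      misses : ∀ {y} → y ∈ arcs diagram → ¬ (∀ s → Free diagram s → Covers y s)
      misses y∈ with x , x∈ , refl ← ∈-map⁻ arc y∈ = arc-misses-free-site x∈

-- Entries outside the matrix are read as 0.
entryℕ : ∀ {m} → Matrix m → ℕ → ℕ → ℕ
entryℕ {m} M i j with i <? m | j <? m
... | yes i<m | yes j<m = M (fromℕ< i<m) (fromℕ< j<m)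
... | _       | _       = 0

module _ {m : ℕ} (M : Matrix m) where

  entryℕ-toℕ : ∀ i j → entryℕ M (toℕ i) (toℕ j) ≡ M i j
  entryℕ-toℕ i j with toℕ i <? m | toℕ j <? m
  ... | yes i<m | yes j<m = cong₂ M (fromℕ<-toℕ i i<m) (fromℕ<-toℕ j j<m)
  ... | no  i≮m | _       = contradiction (toℕ<n i) i≮m
  ... | yes _   | no  j≮m = contradiction (toℕ<n j) j≮m

  entryℕ-sym : SymmetricMatrix M → ∀ i j → entryℕ M i j ≡ entryℕ M j i
  entryℕ-sym M-sym i j with i <? m | j <? m
  ... | yes _ | yes _ = M-sym _ _
  ... | yes _ | no  _ = refl
  ... | no  _ | yes _ = refl
  ... | no  _ | no  _ = refl

  entryℕ-diagonal : DiagonalZero M → ∀ i → entryℕ M i i ≡ 0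
  entryℕ-diagonal diagonal i with i <? m
  ... | yes _ = diagonal _
  ... | no  _ = refl

  entryℕ-first-last : RainbowZero M → entryℕ M 0 (m ∸ 1) ≡ 0
  entryℕ-first-last rainbow with 0 <? m | m ∸ 1 <? m
  ... | yes 0<m | yes last<m = proj₁ (rainbow _ _ (toℕ-fromℕ< 0<m) (toℕ-fromℕ< last<m))
  ... | no  _   | _          = refl
  ... | yes _   | no  _      = refl

diagonal-rainbow-zero⇒realizable : ∀ {f} (M : Matrix (suc f)) → SymmetricMatrix M → ¬ IsZeroMatrix M →
  DiagonalZero M × RainbowZero M → ProperlyRealizable M
diagonal-rainbow-zero⇒realizable {f} M M-sym nonzero (diagonal , rainbow) =
  n , diagram , diagram-proper nonempty , cong suc (sym nfree-diagram) , entries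
  where
    open Construction f (entryℕ M) (entryℕ-sym M M-sym) (entryℕ-diagonal M diagonal) (entryℕ-first-last M rainbow)
    entries : ∀ i j → blockEntry diagram (toℕ i) (toℕ j) ≡ M i j
    entries i j = trans (blockEntry-diagram (toℕ<n i) (toℕ<n j)) (entryℕ-toℕ M i j)
    nonempty : arcs diagram ≢ []
    nonempty no-arcs = nonzero λ i j →
      trans (sym (entries i j)) (countᵇ-none _ (arcs diagram) λ x∈ → case subst (_ ∈_) no-arcs x∈ of λ ())

theorem7p3 : ∀ (m : ℕ) (M : Matrix m) → SymmetricMatrix M → ¬ IsZeroMatrix M →
    (ProperlyRealizable M ⇔ (DiagonalZero M × RainbowZero M)) ×
    (ZeroOneMatrix M → ∀ (n : ℕ) (S : Diagram n) → Proper S → BlockMatrixIs S M → NoParallelArcs S)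
theorem7p3 zero    M _     nonzero = contradiction (λ ()) nonzero
theorem7p3 (suc f) M M-sym nonzero =
  mk⇔ (λ (_ , S , proper , S↦M) → proper⇒diagonal-rainbow-zero S S↦M proper)
      (diagonal-rainbow-zero⇒realizable M M-sym nonzero) ,
  λ zeroOne _ S proper S↦M → proper-zero-one⇒no-parallel-arcs S S↦M proper zeroOne
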